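{- Let $M=(S,s_{init},\mathit{Act},\mathit{Trans})$ be a finite LTS, $B\subseteq\mathit{Act}$ a set of blocking actions, $\rho$ a regular formula and $\alpha_f,\alpha_e\subseteq\mathit{Act}$. A state $s\in S$ satisfies the modal $\mu$-calculus formula $$\neg\langle\rho\rangle\,\nu X.\big(\langle\alpha_e\rangle\mathit{tt}\ \lor\ [\overline{B}]\mathit{ff}\ \lor\ \langle\overline{\alpha_f}\rangle X\big)$$ if, and only if, $s$ does not admit any path that is $B$-progressing and $(\rho,\alpha_f,\alpha_e)$-violating.
   Context: An LTS is $M=(S,s_{init},\mathit{Act},\mathit{Trans})$ with $\mathit{Trans}\subseteq S\times\mathit{Act}\times S$; here $S$ and $\mathit{Act}$ are finite. A path is an alternating sequence $s_0t_1s_1t_2\dots$ of states and transitions, starting with a state, either infinite or ending in a state (its final state), where each $t_{i+1}$ goes from $s_i$ to $s_{i+1}$. An action occurs on a path if some transition on it is labelled with that action; a path is $\alpha$-free if no action of $\alpha$ occurs on it. An action is enabled in $s$ if some transition labelled with it leaves $s$. For $\alpha\subseteq\mathit{Act}$, $\overline{\alpha}=\mathit{Act}\setminus\alpha$. A state is $B$-locked if all actions enabled in it are in $B$; a path is $B$-progressing if it is infinite or its final state is $B$-locked. Regular formulae: $R,Q::=\varepsilon\mid\alpha\mid R\cdot Q\mid R+Q\mid R^*$ with $\alpha\subseteq\mathit{Act}$; a finite path matches $R$ if its sequence of action labels is in the language of $R$ (where $\alpha$ denotes the one-letter words from $\alpha$). A path $\pi$ is $(\rho,\alpha_f,\alpha_e)$-violating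 if $\pi=\pi_{pre}\cdot\pi_{suf}$ (concatenation at a shared state) with $\pi_{pre}$ finite and matching $\rho$, and $\pi_{suf}$ either is $\alpha_f$-free, or contains an occurrence of an action in $\alpha_e$ and the prefix of $\pi_{suf}$ before the first such occurrence is $\alpha_f$-free. Modal $\mu$-calculus: $\phi::=\mathit{ff}\mid X\mid\neg\phi\mid\phi\lor\phi\mid\langle a\rangle\phi\mid\mu X.\phi$ (syntactically monotone) with standard semantics $[\![\cdot]\!]_e$ over environments $e$ mapping variables to sets of states ($\langle a\rangle\phi$ holds in $s$ iff some $a$-transition leads from $s$ to a state satisfying $\phi$; $\mu$ is the least fixpoint). Abbreviations: $\mathit{tt}=\neg\mathit{ff}$, $\land,\Rightarrow$ as usual, $[a]\phi=\neg\langle a\rangle\neg\phi$, $\nu X.\phi=\neg\mu X.\neg\phi[X:=\neg X]$ (greatest fixpoint); a single action $a$ also denotes $\{a\}$; $\langle\alpha\rangle\phi=\bigvee_{a\in\alpha}\langle a\rangle\phi$, $\langle\varepsilon\rangle\phi=\phi$, $\langle R\cdot Q\rangle\phi=\langle R\rangle\langle Q\rangle\phi$, $\langle R+Q\rangle\phi=\langle R\rangle\phi\lor\langle Q\rangle\phi$, $\langle R^*\rangle\phi=\mu Y.(\langle R\rangle Y\lor\phi)$ ($Y$ fresh), $[R]\phi=\neg\langle R\rangle\neg\phi$. -}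

module Defs where

open import Data.Bool using (Bool; true; false; _∧_; _∨_; not; if_then_else_)
open import Data.Nat using (ℕ; zero; suc; _⊔_; _≡ᵇ_)
open import Data.Fin using (Fin)
open import Data.Fin.Subset using (Subset; ⊥; ∁; ⋂; _∈_)
open import Data.Vec using (Vec; []; _∷_; lookup; tabulate)
open import Data.List using (List; []; _∷_; map; foldr; _++_)
open import Data.Product using (Σ; _×_; _,_)
open import Data.Sum using (_⊎_)
open import Data.Unit using (⊤)
open import Data.Empty using () renaming (⊥ to Empty)
open import Relation.Nullary using (¬_)
open import Relation.Binary.PropositionalEquality using (_≡_)

record LTS (n m : ℕ) : Set where
  field
    sinit : Fin n
    trans : Fin n → Fin m → Fin n → Bool
open LTS public

anyFin : ∀ {k} → (Fin k → Bool) → Bool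
anyFin {zero}  f = false
anyFin {suc k} f = f Fin.zero ∨ anyFin {k} (λ i → f (Fin.suc i))

allFin? : ∀ {k} → (Fin k → Bool) → Bool
allFin? {zero}  f = true
allFin? {suc k} f = f Fin.zero ∧ allFin? {k} (λ i → f (Fin.suc i))

allSubsets : ∀ k → List (Subset k)
allSubsets zero    = [] ∷ []
allSubsets (suc k) = map (true ∷_) (allSubsets k) ++ map (false ∷_) (allSubsets k)

filterᵇ : ∀ {A : Set} → (A → Bool) → List A → List A
filterᵇ p []       = []
filterᵇ p (x ∷ xs) = if p x then x ∷ filterᵇ p xs else filterᵇ p xs

_⊆ᵇ_ : ∀ {k} → Subset k → Subset k → Bool
P ⊆ᵇ Q = allFin? (λ i → not (lookup P i) ∨ lookup Q i)

data Form (m : ℕ) : Set where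
  ff  : Form m
  var : ℕ → Form m
  neg : Form m → Form m
  or  : Form m → Form m → Form m
  dia : Fin m → Form m → Form m
  mu  : ℕ → Form m → Form m

Env : ℕ → Set
Env n = ℕ → Subset n

update : ∀ {n} → Env n → ℕ → Subset n → Env n
update e X P Y = if X ≡ᵇ Y then P else e Y

-- standard semantics; μ is the least fixpoint, i.e. the intersection of
-- all prefixpoints (Knaster–Tarski)
⟦_⟧ : ∀ {n m} → Form m → LTS n m → Env n → Subset n
⟦ ff ⟧      M e = ⊥
⟦ var X ⟧   M e = e X
⟦ neg φ ⟧   M e = ∁ (⟦ φ ⟧ M e)
⟦ or φ ψ ⟧  M e = tabulate (λ s → lookup (⟦ φ ⟧ M e) s ∨ lookup (⟦ ψ ⟧ M e) s)
⟦ dia a φ ⟧ M e = tabulate (λ s → anyFin (λ t → trans M s a t ∧ lookup (⟦ φ ⟧ M e) t))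
⟦ mu X φ ⟧  M e = ⋂ (filterᵇ (λ P → ⟦ φ ⟧ M (update e X P) ⊆ᵇ P) (allSubsets _))

tt : ∀ {m} → Form m
tt = neg ff

actionsIn : ∀ {m} → Subset m → List (Fin m)
actionsIn {m} α = filterᵇ (lookup α) (Data.List.allFin m)
  where import Data.List

diaSet : ∀ {m} → Subset m → Form m → Form m
diaSet α φ = foldr (λ a ψ → or (dia a φ) ψ) ff (actionsIn α)

boxSet : ∀ {m} → Subset m → Form m → Form m
boxSet α φ = neg (diaSet α (neg φ))

substNeg : ∀ {m} → ℕ → Form m → Form m
substNeg X ff        = ff
substNeg X (var Y)   = if X ≡ᵇ Y then neg (var Y) else var Y
substNeg X (neg φ)   = neg (substNeg X φ)
substNeg X (or φ ψ)  = or (substNeg X φ) (substNeg X ψ)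
substNeg X (dia a φ) = dia a (substNeg X φ)
substNeg X (mu Y φ)  = if X ≡ᵇ Y then mu Y φ else mu Y (substNeg X φ)

-- νX.φ = ¬μX.¬φ[X:=¬X]
nu : ∀ {m} → ℕ → Form m → Form m
nu X φ = neg (mu X (neg (substNeg X φ)))

maxVar : ∀ {m} → Form m → ℕ
maxVar ff        = 0
maxVar (var Y)   = Y
maxVar (neg φ)   = maxVar φ
maxVar (or φ ψ)  = maxVar φ ⊔ maxVar ψ
maxVar (dia a φ) = maxVar φ
maxVar (mu Y φ)  = Y ⊔ maxVar φ

fresh : ∀ {m} → Form m → ℕ
fresh φ = suc (maxVar φ)

data Reg (m : ℕ) : Set where
  eps  : Reg m
  act  : Subset m → Reg m
  _·_  : Reg m → Reg m → Reg m
  _+_  : Reg m → Reg m → Reg m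
  _*   : Reg m → Reg m

data _∈L_ {m : ℕ} : List (Fin m) → Reg m → Set where
  eps  : [] ∈L eps
  act  : ∀ {a α} → a ∈ α → (a ∷ []) ∈L act α
  cat  : ∀ {u v R Q} → u ∈L R → v ∈L Q → (u ++ v) ∈L (R · Q)
  sumˡ : ∀ {u R Q} → u ∈L R → u ∈L (R + Q)
  sumʳ : ∀ {u R Q} → u ∈L Q → u ∈L (R + Q)
  starε : ∀ {R} → [] ∈L (R *)
  star+ : ∀ {u v R} → u ∈L R → v ∈L (R *) → (u ++ v) ∈L (R *)

diaR : ∀ {m} → Reg m → Form m → Form m
diaR eps     φ = φ
diaR (act α) φ = diaSet α φ
diaR (R · Q) φ = diaR R (diaR Q φ)
diaR (R + Q) φ = or (diaR R φ) (diaR Q φ)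
diaR (R *)   φ = mu Y (or (diaR R (var Y)) φ)
  where Y = fresh φ

-- the formula of the theorem:
-- ¬⟨ρ⟩ νX.(⟨αe⟩tt ∨ [B̄]ff ∨ ⟨ᾱf⟩X)   (X = variable 0)
progFormula : ∀ {m} → Subset m → Reg m → Subset m → Subset m → Form m
progFormula B ρ αf αe =
  neg (diaR ρ (nu 0 (or (diaSet αe tt) (or (boxSet (∁ B) ff) (diaSet (∁ αf) (var 0))))))

emptyEnv : ∀ {n} → Env n
emptyEnv _ = ⊥

module _ {n m : ℕ} (M : LTS n m) where

  data FPath : Fin n → Fin n → Set where
    []  : ∀ {s} → FPath s s
    _◅_ : ∀ {s a t u} → trans M s a t ≡ true → FPath t u → FPath s u

  record IPath (s : Fin n) : Set where
    field
      st    : ℕ → Fin n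
      ac    : ℕ → Fin m
      start : st 0 ≡ s
      valid : ∀ i → trans M (st i) (ac i) (st (suc i)) ≡ true

  data Path (s : Fin n) : Set where
    fin : ∀ {t} → FPath s t → Path s
    inf : IPath s → Path s

  labels : ∀ {s t} → FPath s t → List (Fin m)
  labels []                 = []
  labels (_◅_ {a = a} _ p) = a ∷ labels p

  _++ᶠ_ : ∀ {s t u} → FPath s t → FPath t u → FPath s u
  []      ++ᶠ q = q
  (x ◅ p) ++ᶠ q = x ◅ (p ++ᶠ q)

  consI : ∀ {s a t} → trans M s a t ≡ true → IPath t → IPath s
  consI {s} {a} {t} x π = record { st = st' ; ac = ac' ; start = _≡_.refl ; valid = v }
    where
      open IPath π
      st' : ℕ → Fin n
      st' zero    = s
      st' (suc i) = st i
      ac' : ℕ → Fin m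
      ac' zero    = a
      ac' (suc i) = ac i
      v : ∀ i → trans M (st' i) (ac' i) (st' (suc i)) ≡ true
      v zero    rewrite start = x
      v (suc i) = valid i

  _++ⁱ_ : ∀ {s t} → FPath s t → IPath t → IPath s
  []      ++ⁱ π = π
  (x ◅ p) ++ⁱ π = consI x (p ++ⁱ π)

  _++ₚ_ : ∀ {s t} → FPath s t → Path t → Path s
  p ++ₚ fin q = fin (p ++ᶠ q)
  p ++ₚ inf π = inf (p ++ⁱ π)

  _◅ₚ_ : ∀ {s a t} → trans M s a t ≡ true → Path t → Path s
  x ◅ₚ fin q = fin (x ◅ q)
  x ◅ₚ inf π = inf (consI x π)

  FFree : Subset m → ∀ {s t} → FPath s t → Set
  FFree α []                 = ⊤
  FFree α (_◅_ {a = a} _ p) = (¬ a ∈ α) × FFree α p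

  Free : Subset m → ∀ {s} → Path s → Set
  Free α (fin p) = FFree α p
  Free α (inf π) = ∀ i → ¬ IPath.ac π i ∈ α

  Locked : Subset m → Fin n → Set
  Locked B s = ∀ a t → trans M s a t ≡ true → a ∈ B

  Progressing : Subset m → ∀ {s} → Path s → Set
  Progressing B (fin {t} p) = Locked B t
  Progressing B (inf π)     = ⊤

  SuffixOK : Subset m → Subset m → ∀ {t} → Path t → Set
  SuffixOK αf αe {t} suf =
    Free αf suf ⊎
    Σ (Fin n) λ u → Σ (FPath t u) λ p₁ → Σ (Fin m) λ a → Σ (Fin n) λ v →
    Σ (trans M u a v ≡ true) λ x → Σ (Path v) λ rest →
      (suf ≡ p₁ ++ₚ (x ◅ₚ rest)) × a ∈ αe × FFree αe p₁ × FFree αf p₁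

  Violating : Reg m → Subset m → Subset m → ∀ {s} → Path s → Set
  Violating ρ αf αe {s} π =
    Σ (Fin n) λ t → Σ (FPath s t) λ pre → Σ (Path t) λ suf →
      (π ≡ pre ++ₚ suf) × labels pre ∈L ρ × SuffixOK αf αe suf

{-# OPTIONS --safe #-}
module Submission where

-- ⟨ρ⟩ψ holds exactly in the states from which a path matching ρ reaches a ψ-state, and
-- ψ = νX.(⟨αe⟩tt ∨ [B̄]ff ∨ ⟨ᾱf⟩X) is the greatest set of states each of which has an
-- αe-action enabled, is B-locked, or has an ᾱf-step back into the set.  The states from
-- which a B-progressing suffix as in the definition of violation starts form such a
-- post-fixpoint, so they lie in ψ by coinduction.  Conversely, from a ψ-state either an
-- αf- and αe-free path reaches a state that is B-locked or enables an αe-action (stop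
-- there, or take that action and continue along any progressing path), or no such path
-- exists and the ᾱf-steps that ψ provides unfold into an infinite αf-free path.
-- Constructively these paths exist only up to double negation; that suffices, because the
-- right-hand side is a negation and membership in a finite subset is decidable.

open import Defs
open import Data.Nat using (ℕ)
open import Data.Fin using (Fin)
open import Data.Fin.Subset using (Subset; _∈_)
open import Data.Product using (Σ; _×_)
open import Relation.Nullary using (¬_)
open import Function.Bundles using (_⇔_)

open import Algebra.Lattice.Properties.BooleanAlgebra using (¬-involutive)
open import Data.Bool using (Bool; true; false; T; not; _∧_; _∨_; _≟_)
open import Data.Bool.Properties using (T-≡; T-∧; T-∨)
open import Data.Empty using (⊥-elim)
import Data.Fin as F
open import Data.Fin.Properties using (any?; ⊎⇔∃; ∀-cons-⇔)
open import Data.Fin.Subset using (⊤; ∁; ⋂; _∉_; _⊆_)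
open import Data.Fin.Subset.Properties
  using ( _∈?_; ∈⊤; ∉⊥; x∈p∩q⁺; x∈p∩q⁻; x∈∁p⇒x∉p; x∉p⇒x∈∁p; x∉∁p⇒x∈p; p⊆q⇒∁p⊇∁q
        ; ⊆-antisym; ∪-∩-booleanAlgebra)
open import Data.List using (List; []; _∷_; _++_; foldr; allFin)
open import Data.List.Properties using (∷-injective)
open import Data.List.Relation.Unary.Any using (here; there)
open import Data.List.Membership.Propositional using () renaming (_∈_ to _∈ₗ_)
open import Data.List.Membership.Propositional.Properties using (∈-map⁺; ∈-++⁺ˡ; ∈-++⁺ʳ; ∈-allFin)
open import Data.Nat using (zero; suc; _≤_; s≤s; _≡ᵇ_)
open import Data.Nat.Properties using (≤-refl; ≤-trans; m≤m⊔n; m≤n⊔m; ≡ᵇ⇒≡; ≡⇒≡ᵇ; >⇒≢)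
open import Data.Product using (_,_; proj₁; proj₂; ∃; ∃₂)
open import Data.Product.Function.NonDependent.Propositional using (_×-⇔_)
open import Data.Sum using (_⊎_; inj₁; inj₂; [_,_]′)
import Data.Sum as Sum
open import Data.Sum.Function.Propositional using (_⊎-⇔_)
open import Data.Vec using ([]; _∷_; lookup; tabulate)
open import Data.Vec.Properties using ([]=↔lookup; lookup∘tabulate)
open import Effect.Monad using (RawMonad)
open import Function using (_∘_; case_of_)
open import Function.Bundles using (mk⇔; module Equivalence)
open import Function.Construct.Identity using (⇔-id)
open import Function.Construct.Symmetry using (⇔-sym)
open import Function.Properties.Equivalence using () renaming (trans to ⇔-trans)
open import Function.Properties.Inverse using (↔⇒⇔)
open import Level using (0ℓ)
open import Relation.Binary using (_Preserves_⟶_)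
open import Relation.Binary.PropositionalEquality
  using (_≡_; _≢_; refl; sym; cong; cong₂; subst; module ≡-Reasoning)
  renaming (trans to ≡-trans)
open import Relation.Nullary using (Dec; yes; no)
open import Relation.Nullary.Decidable
  using (isYes; toWitness; fromWitness; decidable-stable; ¬¬-excluded-middle)
open import Relation.Nullary.Negation using (¬¬-Monad; contradiction)
open import Relation.Unary using (U)

open Equivalence using (to; from)
open RawMonad (¬¬-Monad {a = 0ℓ}) using (_>>=_; return)

T-anyFin : ∀ {k} (f : Fin k → Bool) → T (anyFin f) ⇔ ∃ (T ∘ f)
T-anyFin {zero}  f = mk⇔ (λ ()) (λ ())
T-anyFin {suc k} f = ⇔-trans T-∨ (⇔-trans (⇔-id _ ⊎-⇔ T-anyFin (f ∘ F.suc)) ⊎⇔∃)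

T-allFin? : ∀ {k} (f : Fin k → Bool) → T (allFin? f) ⇔ (∀ i → T (f i))
T-allFin? {zero}  f = mk⇔ (λ _ ()) _
T-allFin? {suc k} f = ⇔-trans T-∧ (⇔-trans (⇔-id _ ×-⇔ T-allFin? (f ∘ F.suc)) ∀-cons-⇔)

T-not-∨ : ∀ {b c} → T (not b ∨ c) ⇔ (T b → T c)
T-not-∨ {true}  = mk⇔ (λ c _ → c) (λ f → f _)
T-not-∨ {false} = mk⇔ (λ _ ()) _

∈-filterᵇ⁺ : ∀ {A : Set} (p : A → Bool) {xs x} → x ∈ₗ xs → T (p x) → x ∈ₗ filterᵇ p xs
∈-filterᵇ⁺ p {y ∷ _} (here refl) px with p y
... | true = here refl
∈-filterᵇ⁺ p {y ∷ _} (there x∈) px with p y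
... | true  = there (∈-filterᵇ⁺ p x∈ px)
... | false = ∈-filterᵇ⁺ p x∈ px

∈-filterᵇ⁻ : ∀ {A : Set} (p : A → Bool) xs {x} → x ∈ₗ filterᵇ p xs → T (p x)
∈-filterᵇ⁻ p (y ∷ xs) x∈ with p y in py
∈-filterᵇ⁻ p (y ∷ xs) (here refl) | true  = from T-≡ py
∈-filterᵇ⁻ p (y ∷ xs) (there x∈)  | true  = ∈-filterᵇ⁻ p xs x∈
∈-filterᵇ⁻ p (y ∷ xs) x∈          | false = ∈-filterᵇ⁻ p xs x∈

∈-allSubsets : ∀ {k} (P : Subset k) → P ∈ₗ allSubsets k
∈-allSubsets []          = here refl
∈-allSubsets (true ∷ P)  = ∈-++⁺ˡ (∈-map⁺ (true ∷_) (∈-allSubsets P))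
∈-allSubsets (false ∷ P) = ∈-++⁺ʳ _ (∈-map⁺ (false ∷_) (∈-allSubsets P))

¬¬-decidable : ∀ {n} (Q : Fin n → Set) → ¬ ¬ (∀ t → Dec (Q t))
¬¬-decidable {zero}  Q = return λ ()
¬¬-decidable {suc n} Q = do
  Q₀? ← ¬¬-excluded-middle
  Q∘suc? ← ¬¬-decidable (Q ∘ F.suc)
  return λ { F.zero → Q₀? ; (F.suc t) → Q∘suc? t }

module _ {n : ℕ} where

  ∈⇔T-lookup : ∀ {p : Subset n} {x} → x ∈ p ⇔ T (lookup p x)
  ∈⇔T-lookup = ⇔-trans (↔⇒⇔ []=↔lookup) (⇔-sym T-≡)

  ∈-tabulate : ∀ {f : Fin n → Bool} {x} → x ∈ tabulate f ⇔ T (f x)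
  ∈-tabulate {f} {x} = subst (λ b → x ∈ tabulate f ⇔ T b) (lookup∘tabulate f x) ∈⇔T-lookup

  ∈-actionsIn : ∀ {α : Subset n} {a} → a ∈ₗ actionsIn α ⇔ a ∈ α
  ∈-actionsIn {α} {a} = mk⇔
    (from ∈⇔T-lookup ∘ ∈-filterᵇ⁻ (lookup α) (allFin n))
    (∈-filterᵇ⁺ (lookup α) (∈-allFin a) ∘ to ∈⇔T-lookup)

  ∁-involutive : ∀ (p : Subset n) → ∁ (∁ p) ≡ p
  ∁-involutive = ¬-involutive (∪-∩-booleanAlgebra n)

  ⊆ᵇ⇔⊆ : ∀ {P Q : Subset n} → T (P ⊆ᵇ Q) ⇔ P ⊆ Q
  ⊆ᵇ⇔⊆ {P} {Q} = mk⇔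
    (λ P⊆ᵇQ {x} x∈P →
      from ∈⇔T-lookup (to T-not-∨ (to (T-allFin? P⇒Q) P⊆ᵇQ x) (to ∈⇔T-lookup x∈P)))
    (λ P⊆Q → from (T-allFin? P⇒Q) λ x →
      from T-not-∨ (to ∈⇔T-lookup ∘ P⊆Q ∘ from ∈⇔T-lookup))
    where
    P⇒Q : Fin n → Bool
    P⇒Q x = not (lookup P x) ∨ lookup Q x

  ∈-⋂ : ∀ (Ps : List (Subset n)) {x} → x ∈ ⋂ Ps ⇔ (∀ {P} → P ∈ₗ Ps → x ∈ P)
  ∈-⋂ []       = mk⇔ (λ _ ()) (λ _ → ∈⊤)
  ∈-⋂ (P ∷ Ps) = mk⇔
    (λ x∈ → λ { (here refl) → proj₁ (x∈p∩q⁻ P _ x∈)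
              ; (there P∈) → to (∈-⋂ Ps) (proj₂ (x∈p∩q⁻ P _ x∈)) P∈ })
    (λ x∈Ps → x∈p∩q⁺ (x∈Ps (here refl) , from (∈-⋂ Ps) (λ P∈ → x∈Ps (there P∈))))

  ¬¬-subset : (Q : Fin n → Set) → ¬ ¬ (Σ (Subset n) λ P → ∀ {t} → t ∈ P ⇔ Q t)
  ¬¬-subset Q = do
    Q? ← ¬¬-decidable Q
    return (tabulate (isYes ∘ Q?) , λ {_} →
      mk⇔ (toWitness ∘ to ∈-tabulate) (from ∈-tabulate ∘ fromWitness))

module _ {n : ℕ} where

  -- ⟦ mu X φ ⟧ M e is, by definition, lfp (λ P → ⟦ φ ⟧ M (update e X P)).
  lfp : (Subset n → Subset n) → Subset n
  lfp F = ⋂ (filterᵇ (λ P → F P ⊆ᵇ P) (allSubsets n))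

  ∈-lfp : ∀ F {x} → x ∈ lfp F ⇔ (∀ P → F P ⊆ P → x ∈ P)
  ∈-lfp F {x} = mk⇔ in-prefixed in-lfp
    where
    prefixed? : Subset n → Bool
    prefixed? P = F P ⊆ᵇ P

    in-prefixed : x ∈ lfp F → ∀ P → F P ⊆ P → x ∈ P
    in-prefixed x∈ P FP⊆P =
      to (∈-⋂ _) x∈ (∈-filterᵇ⁺ prefixed? (∈-allSubsets P) (from (⊆ᵇ⇔⊆ {P = F P} {Q = P}) FP⊆P))

    in-lfp : (∀ P → F P ⊆ P → x ∈ P) → x ∈ lfp F
    in-lfp x∈pre = from (∈-⋂ _) λ {P} P∈ →
      x∈pre P (to (⊆ᵇ⇔⊆ {P = F P} {Q = P}) (∈-filterᵇ⁻ prefixed? (allSubsets n) P∈))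

  lfp-least : ∀ F {P} → F P ⊆ P → lfp F ⊆ P
  lfp-least F {P} FP⊆P x∈ = to (∈-lfp F) x∈ P FP⊆P

  lfp-prefixed : ∀ F → F Preserves _⊆_ ⟶ _⊆_ → F (lfp F) ⊆ lfp F
  lfp-prefixed F mono x∈ = from (∈-lfp F) λ P FP⊆P → FP⊆P (mono (lfp-least F FP⊆P) x∈)

  lfp-cong : ∀ {F G} → (∀ P → F P ≡ G P) → lfp F ≡ lfp G
  lfp-cong F≗G = ⊆-antisym (lfp-⊆ F≗G) (lfp-⊆ (sym ∘ F≗G))
    where
    lfp-⊆ : ∀ {F G} → (∀ P → F P ≡ G P) → lfp F ⊆ lfp G
    lfp-⊆ {F} {G} F≗G x∈ =
      from (∈-lfp G) λ P GP⊆P → to (∈-lfp F) x∈ P (subst (_⊆ P) (sym (F≗G P)) GP⊆P)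

  gfp : (Subset n → Subset n) → Subset n
  gfp F = ∁ (lfp (λ P → ∁ (F (∁ P))))

  gfp-greatest : ∀ F {P} → P ⊆ F P → P ⊆ gfp F
  gfp-greatest F {P} P⊆FP x∈P =
    x∉p⇒x∈∁p λ x∈lfp → x∈∁p⇒x∉p (lfp-least (λ Q → ∁ (F (∁ Q))) ∁F∁∁P⊆∁P x∈lfp) x∈P
    where
    ∁F∁∁P⊆∁P : ∁ (F (∁ (∁ P))) ⊆ ∁ P
    ∁F∁∁P⊆∁P rewrite ∁-involutive P = p⊆q⇒∁p⊇∁q P⊆FP

  gfp-postfixed : ∀ F → F Preserves _⊆_ ⟶ _⊆_ → gfp F ⊆ F (gfp F)
  gfp-postfixed F mono {x} x∈ = decidable-stable (x ∈? F (gfp F)) λ x∉ →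
    x∈∁p⇒x∉p x∈ (lfp-prefixed (λ Q → ∁ (F (∁ Q))) (p⊆q⇒∁p⊇∁q ∘ mono ∘ p⊆q⇒∁p⊇∁q) (x∉p⇒x∈∁p x∉))

module _ {n m : ℕ} (M : LTS n m) where

  ◇ : Subset m → (Fin n → Set) → Fin n → Set
  ◇ α Q s = ∃₂ λ a t → a ∈ α × trans M s a t ≡ true × Q t

  ◇-map : ∀ {α Q R} → (∀ {t} → Q t → R t) → ∀ {s} → ◇ α Q s → ◇ α R s
  ◇-map f (a , t , a∈α , x , q) = a , t , a∈α , x , f q

  Enabled : Subset m → Fin n → Set
  Enabled α = ◇ α U

  ∈⟦tt⟧ : ∀ e {s} → s ∈ ⟦ tt ⟧ M e
  ∈⟦tt⟧ e = x∉p⇒x∈∁p ∉⊥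

  ∈⟦or⟧ : ∀ φ ψ e {s} → s ∈ ⟦ or φ ψ ⟧ M e ⇔ (s ∈ ⟦ φ ⟧ M e ⊎ s ∈ ⟦ ψ ⟧ M e)
  ∈⟦or⟧ φ ψ e = ⇔-trans ∈-tabulate (⇔-trans T-∨ (⇔-sym ∈⇔T-lookup ⊎-⇔ ⇔-sym ∈⇔T-lookup))

  ∈⟦dia⟧ : ∀ a φ e {s} → s ∈ ⟦ dia a φ ⟧ M e ⇔ ∃ λ t → trans M s a t ≡ true × t ∈ ⟦ φ ⟧ M e
  ∈⟦dia⟧ a φ e {s} = mk⇔
    (λ s∈ → let (t , step) = to (T-anyFin step?) (to ∈-tabulate s∈)
                (x , t∈)   = to T-∧ step
            in t , to T-≡ x , from ∈⇔T-lookup t∈)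
    (λ (t , x , t∈) →
      from ∈-tabulate (from (T-anyFin step?) (t , from T-∧ (from T-≡ x , to ∈⇔T-lookup t∈))))
    where
    step? : Fin n → Bool
    step? t = trans M s a t ∧ lookup (⟦ φ ⟧ M e) t

  ⋁dia : List (Fin m) → Form m → Form m
  ⋁dia as φ = foldr (λ a ψ → or (dia a φ) ψ) ff as

  ∈⟦⋁dia⟧ : ∀ as φ e {s} →
    s ∈ ⟦ ⋁dia as φ ⟧ M e ⇔ ∃₂ λ a t → a ∈ₗ as × trans M s a t ≡ true × t ∈ ⟦ φ ⟧ M e
  ∈⟦⋁dia⟧ []       φ e = mk⇔ (⊥-elim ∘ ∉⊥) (λ { (_ , _ , () , _) })
  ∈⟦⋁dia⟧ (b ∷ as) φ e = mk⇔
    ([ (λ s∈ → let (t , x , t∈) = to (∈⟦dia⟧ b φ e) s∈ in b , t , here refl , x , t∈)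
     , (λ s∈ → let (a , t , a∈ , x , t∈) = to (∈⟦⋁dia⟧ as φ e) s∈ in a , t , there a∈ , x , t∈)
     ]′ ∘ to ∈⟦b∨as⟧)
    (λ { (a , t , here refl , x , t∈) → from ∈⟦b∨as⟧ (inj₁ (from (∈⟦dia⟧ b φ e) (t , x , t∈)))
       ; (a , t , there a∈ , x , t∈) →
           from ∈⟦b∨as⟧ (inj₂ (from (∈⟦⋁dia⟧ as φ e) (a , t , a∈ , x , t∈)))
       })
    where
    ∈⟦b∨as⟧ = ∈⟦or⟧ (dia b φ) (⋁dia as φ) e

  ∈⟦diaSet⟧ : ∀ α φ e {s} → s ∈ ⟦ diaSet α φ ⟧ M e ⇔ ◇ α (_∈ ⟦ φ ⟧ M e) s
  ∈⟦diaSet⟧ α φ e = mk⇔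
    (λ s∈ → let (a , t , a∈ , x , t∈) = to (∈⟦⋁dia⟧ (actionsIn α) φ e) s∈
            in a , t , to ∈-actionsIn a∈ , x , t∈)
    (λ (a , t , a∈α , x , t∈) →
      from (∈⟦⋁dia⟧ (actionsIn α) φ e) (a , t , from ∈-actionsIn a∈α , x , t∈))

  ∈⟦⟨α⟩tt⟧ : ∀ α e {s} → s ∈ ⟦ diaSet α tt ⟧ M e ⇔ Enabled α s
  ∈⟦⟨α⟩tt⟧ α e = mk⇔
    (◇-map _ ∘ to (∈⟦diaSet⟧ α tt e))
    (from (∈⟦diaSet⟧ α tt e) ∘ ◇-map (λ _ → ∈⟦tt⟧ e))

  ∈⟦[∁B]ff⟧ : ∀ B e {s} → s ∈ ⟦ boxSet (∁ B) ff ⟧ M e ⇔ Locked M B s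
  ∈⟦[∁B]ff⟧ B e = mk⇔
    (λ s∈ a t x → x∉∁p⇒x∈p λ a∈∁B → x∈∁p⇒x∉p s∈ (from (∈⟦⟨α⟩tt⟧ (∁ B) e) (a , t , a∈∁B , x , _)))
    (λ locked → x∉p⇒x∈∁p λ s∈ →
      let (a , t , a∈∁B , x , _) = to (∈⟦⟨α⟩tt⟧ (∁ B) e) s∈ in x∈∁p⇒x∉p a∈∁B (locked a t x))

  update-hit : ∀ (e : Env n) X P → update e X P X ≡ P
  update-hit e X P with X ≡ᵇ X | ≡⇒≡ᵇ X X refl
  ... | true  | _  = refl
  ... | false | ()

  update-miss : ∀ (e : Env n) {X Y} P → X ≢ Y → update e X P Y ≡ e Y
  update-miss e {X} {Y} P X≢Y with X ≡ᵇ Y in X≡ᵇY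
  ... | true  = contradiction (≡ᵇ⇒≡ X Y (from T-≡ X≡ᵇY)) X≢Y
  ... | false = refl

  update-shadow : ∀ (e : Env n) X P Q Z → update (update e X P) X Q Z ≡ update e X Q Z
  update-shadow e X P Q Z with X ≡ᵇ Z
  ... | true  = refl
  ... | false = refl

  update-comm : ∀ (e : Env n) {X Y} P Q → X ≢ Y → ∀ Z →
    update (update e X P) Y Q Z ≡ update (update e Y Q) X P Z
  update-comm e {X} {Y} P Q X≢Y Z with X ≡ᵇ Z in X≡ᵇZ | Y ≡ᵇ Z in Y≡ᵇZ
  ... | true  | true  =
    contradiction (≡-trans (≡ᵇ⇒≡ X Z (from T-≡ X≡ᵇZ)) (sym (≡ᵇ⇒≡ Y Z (from T-≡ Y≡ᵇZ)))) X≢Y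
  ... | true  | false = refl
  ... | false | true  = refl
  ... | false | false = refl

  ⟦⟧-agree : ∀ φ {e e' : Env n} → (∀ {X} → X ≤ maxVar φ → e X ≡ e' X) → ⟦ φ ⟧ M e ≡ ⟦ φ ⟧ M e'
  ⟦⟧-agree ff        agree = refl
  ⟦⟧-agree (var X)   agree = agree ≤-refl
  ⟦⟧-agree (neg φ)   agree = cong ∁ (⟦⟧-agree φ agree)
  ⟦⟧-agree (or φ ψ)  agree = cong₂ (λ A B → tabulate λ s → lookup A s ∨ lookup B s)
    (⟦⟧-agree φ λ X≤ → agree (≤-trans X≤ (m≤m⊔n (maxVar φ) (maxVar ψ))))
    (⟦⟧-agree ψ λ X≤ → agree (≤-trans X≤ (m≤n⊔m (maxVar φ) (maxVar ψ))))
  ⟦⟧-agree (dia a φ) agree = cong (λ A → tabulate λ s → anyFin λ t → trans M s a t ∧ lookup A t)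
    (⟦⟧-agree φ agree)
  ⟦⟧-agree (mu Z φ) {e} {e'} agree = lfp-cong λ P → ⟦⟧-agree φ (agree-under P)
    where
    agree-under : ∀ P {X} → X ≤ maxVar φ → update e Z P X ≡ update e' Z P X
    agree-under P {X} X≤ with Z ≡ᵇ X
    ... | true  = refl
    ... | false = agree (≤-trans X≤ (m≤n⊔m Z (maxVar φ)))

  ⟦⟧-cong : ∀ φ {e e' : Env n} → (∀ X → e X ≡ e' X) → ⟦ φ ⟧ M e ≡ ⟦ φ ⟧ M e'
  ⟦⟧-cong φ e≗e' = ⟦⟧-agree φ λ {X} _ → e≗e' X

  ⟦⟧-fresh : ∀ φ e P → ⟦ φ ⟧ M (update e (fresh φ) P) ≡ ⟦ φ ⟧ M e
  ⟦⟧-fresh φ e P = ⟦⟧-agree φ λ X≤ → update-miss e P (>⇒≢ (s≤s X≤))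

  ⟦substNeg⟧ : ∀ X φ e P → ⟦ substNeg X φ ⟧ M (update e X P) ≡ ⟦ φ ⟧ M (update e X (∁ P))
  ⟦substNeg⟧ X ff        e P = refl
  ⟦substNeg⟧ X (var Y)   e P with X ≡ᵇ Y in X≡ᵇY
  ... | true  rewrite X≡ᵇY = refl
  ... | false rewrite X≡ᵇY = refl
  ⟦substNeg⟧ X (neg φ)   e P = cong ∁ (⟦substNeg⟧ X φ e P)
  ⟦substNeg⟧ X (or φ ψ)  e P = cong₂ (λ A B → tabulate λ s → lookup A s ∨ lookup B s)
    (⟦substNeg⟧ X φ e P) (⟦substNeg⟧ X ψ e P)
  ⟦substNeg⟧ X (dia a φ) e P = cong (λ A → tabulate λ s → anyFin λ t → trans M s a t ∧ lookup A t)
    (⟦substNeg⟧ X φ e P)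
  ⟦substNeg⟧ X (mu Y φ)  e P with X ≡ᵇ Y in X≡ᵇY
  ... | true rewrite ≡ᵇ⇒≡ X Y (from T-≡ X≡ᵇY) = lfp-cong λ Q → ⟦⟧-cong φ λ Z →
    ≡-trans (update-shadow e Y P Q Z) (sym (update-shadow e Y (∁ P) Q Z))
  ... | false = lfp-cong λ Q → begin
    ⟦ substNeg X φ ⟧ M (update (update e X P) Y Q)  ≡⟨ ⟦⟧-cong (substNeg X φ) (update-comm e P Q X≢Y) ⟩
    ⟦ substNeg X φ ⟧ M (update (update e Y Q) X P)  ≡⟨ ⟦substNeg⟧ X φ (update e Y Q) P ⟩
    ⟦ φ ⟧ M (update (update e Y Q) X (∁ P))         ≡⟨ ⟦⟧-cong φ (update-comm e (∁ P) Q X≢Y) ⟨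
    ⟦ φ ⟧ M (update (update e X (∁ P)) Y Q)         ∎
    where
    open ≡-Reasoning
    X≢Y : X ≢ Y
    X≢Y X≡Y = subst T X≡ᵇY (≡⇒≡ᵇ X Y X≡Y)

  ⟦nu⟧≡gfp : ∀ X φ e → ⟦ nu X φ ⟧ M e ≡ gfp (λ P → ⟦ φ ⟧ M (update e X P))
  ⟦nu⟧≡gfp X φ e = cong ∁ (lfp-cong λ P → cong ∁ (⟦substNeg⟧ X φ e P))

  labels-++ᶠ : ∀ {s t u} (p : FPath M s t) (q : FPath M t u) →
    labels M (_++ᶠ_ M p q) ≡ labels M p ++ labels M q
  labels-++ᶠ []      q = refl
  labels-++ᶠ (x ◅ p) q = cong (_ ∷_) (labels-++ᶠ p q)

  split-labels : ∀ {s t} (p : FPath M s t) u v → labels M p ≡ u ++ v →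
    ∃ λ w → Σ (FPath M s w) λ p₁ → Σ (FPath M w t) λ p₂ → labels M p₁ ≡ u × labels M p₂ ≡ v
  split-labels p       []      v eq = _ , [] , p , refl , eq
  split-labels (x ◅ p) (a ∷ u) v eq with refl , eq′ ← ∷-injective eq =
    let (w , p₁ , p₂ , eq₁ , eq₂) = split-labels p u v eq′
    in w , x ◅ p₁ , p₂ , cong (a ∷_) eq₁ , eq₂

  ∈L-· : ∀ {s t u R Q} (p : FPath M s t) (q : FPath M t u) →
    labels M p ∈L R → labels M q ∈L Q → labels M (_++ᶠ_ M p q) ∈L (R · Q)
  ∈L-· p q p∈R q∈Q = subst (_∈L _) (sym (labels-++ᶠ p q)) (cat p∈R q∈Q)

  ∈L-* : ∀ {s t u R} (p : FPath M s t) (q : FPath M t u) →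
    labels M p ∈L R → labels M q ∈L (R *) → labels M (_++ᶠ_ M p q) ∈L (R *)
  ∈L-* p q p∈R q∈R* = subst (_∈L _) (sym (labels-++ᶠ p q)) (star+ p∈R q∈R*)

  Reaches : Reg m → Subset n → Fin n → Set
  Reaches R T s = ∃ λ t → Σ (FPath M s t) λ p → labels M p ∈L R × t ∈ T

  -- ⟦ diaR (R *) φ ⟧ M e is, by definition, lfp (starBody R φ e).
  starBody : Reg m → Form m → Env n → Subset n → Subset n
  starBody R φ e P = ⟦ or (diaR R (var (fresh φ))) φ ⟧ M (update e (fresh φ) P)

  ⟦diaR⟧-sound : ∀ {w R} → w ∈L R → ∀ φ e {s t} (p : FPath M s t) → labels M p ≡ w →
    t ∈ ⟦ φ ⟧ M e → s ∈ ⟦ diaR R φ ⟧ M e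
  ⟦diaR⟧-sound eps       φ e []       refl t∈ = t∈
  ⟦diaR⟧-sound (act a∈α) φ e (x ◅ []) refl t∈ = from (∈⟦diaSet⟧ _ φ e) (_ , _ , a∈α , x , t∈)
  ⟦diaR⟧-sound (cat {u} {v} {R} {Q} u∈R v∈Q) φ e p eq t∈ =
    let (w , p₁ , p₂ , eq₁ , eq₂) = split-labels p u v eq
    in ⟦diaR⟧-sound u∈R (diaR Q φ) e p₁ eq₁ (⟦diaR⟧-sound v∈Q φ e p₂ eq₂ t∈)
  ⟦diaR⟧-sound (sumˡ {R = R} {Q} w∈R) φ e p eq t∈ =
    from (∈⟦or⟧ (diaR R φ) (diaR Q φ) e) (inj₁ (⟦diaR⟧-sound w∈R φ e p eq t∈))
  ⟦diaR⟧-sound (sumʳ {R = R} {Q} w∈Q) φ e p eq t∈ =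
    from (∈⟦or⟧ (diaR R φ) (diaR Q φ) e) (inj₂ (⟦diaR⟧-sound w∈Q φ e p eq t∈))
  ⟦diaR⟧-sound (starε {R}) φ e [] refl t∈ = from (∈-lfp (starBody R φ e)) λ P prefixed →
    prefixed (from (∈⟦or⟧ (diaR R (var (fresh φ))) φ _)
      (inj₂ (subst (_ ∈_) (sym (⟦⟧-fresh φ e P)) t∈)))
  ⟦diaR⟧-sound (star+ {u} {v} {R} u∈R v∈R*) φ e p eq t∈ =
    let (w , p₁ , p₂ , eq₁ , eq₂) = split-labels p u v eq
        w∈⟨R*⟩φ = ⟦diaR⟧-sound v∈R* φ e p₂ eq₂ t∈
        Y = fresh φ
    in from (∈-lfp (starBody R φ e)) λ P prefixed →
         prefixed (from (∈⟦or⟧ (diaR R (var Y)) φ _) (inj₁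
           (⟦diaR⟧-sound u∈R (var Y) (update e Y P) p₁ eq₁
             (subst (w ∈_) (sym (update-hit e Y P))
               (to (∈-lfp (starBody R φ e)) w∈⟨R*⟩φ P prefixed)))))

  ⟦diaR⟧-complete : ∀ R φ e {s} → s ∈ ⟦ diaR R φ ⟧ M e → ¬ ¬ Reaches R (⟦ φ ⟧ M e) s
  ⟦diaR⟧-complete eps     φ e {s} s∈ = return (s , [] , eps , s∈)
  ⟦diaR⟧-complete (act α) φ e s∈ =
    let (a , t , a∈α , x , t∈) = to (∈⟦diaSet⟧ α φ e) s∈ in return (t , x ◅ [] , act a∈α , t∈)
  ⟦diaR⟧-complete (R · Q) φ e s∈ = do
    (u , p , p∈R , u∈) ← ⟦diaR⟧-complete R (diaR Q φ) e s∈
    (t , q , q∈Q , t∈) ← ⟦diaR⟧-complete Q φ e u∈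
    return (t , _++ᶠ_ M p q , ∈L-· p q p∈R q∈Q , t∈)
  ⟦diaR⟧-complete (R + Q) φ e s∈ with to (∈⟦or⟧ (diaR R φ) (diaR Q φ) e) s∈
  ... | inj₁ s∈R = do
    (t , p , p∈R , t∈) ← ⟦diaR⟧-complete R φ e s∈R
    return (t , p , sumˡ p∈R , t∈)
  ... | inj₂ s∈Q = do
    (t , p , p∈Q , t∈) ← ⟦diaR⟧-complete Q φ e s∈Q
    return (t , p , sumʳ p∈Q , t∈)
  ⟦diaR⟧-complete (R *) φ e s∈ = do
    (P , ∈P⇔) ← ¬¬-subset (Reaches (R *) (⟦ φ ⟧ M e))
    return (to ∈P⇔ (lfp-least (starBody R φ e) (prefixed P ∈P⇔) s∈))
    where
    Y = fresh φ
    prefixed : ∀ P → (∀ {t} → t ∈ P ⇔ Reaches (R *) (⟦ φ ⟧ M e) t) → starBody R φ e P ⊆ P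
    prefixed P ∈P⇔ {s} s∈ = decidable-stable (s ∈? P) (case to (∈⟦or⟧ (diaR R (var Y)) φ _) s∈ of λ
      { (inj₁ s∈R) → do
          (u , p , p∈R , u∈) ← ⟦diaR⟧-complete R (var Y) (update e Y P) s∈R
          let (t , q , q∈R* , t∈) = to ∈P⇔ (subst (u ∈_) (update-hit e Y P) u∈)
          return (from ∈P⇔ (t , _++ᶠ_ M p q , ∈L-* p q p∈R q∈R* , t∈))
      ; (inj₂ s∈φ) → return (from ∈P⇔ (s , [] , starε , subst (s ∈_) (⟦⟧-fresh φ e P) s∈φ))
      })

  Progressing-++ₚ : ∀ {B s t} (p : FPath M s t) (q : Path M t) →
    Progressing M B (_++ₚ_ M p q) ⇔ Progressing M B q
  Progressing-++ₚ p (fin q) = ⇔-id _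
  Progressing-++ₚ p (inf π) = ⇔-id _

  Progressing-◅ₚ : ∀ {B s a t} (x : trans M s a t ≡ true) (q : Path M t) →
    Progressing M B (_◅ₚ_ M x q) ⇔ Progressing M B q
  Progressing-◅ₚ x (fin q) = ⇔-id _
  Progressing-◅ₚ x (inf π) = ⇔-id _

  headᴵ : ∀ {s} (π : IPath M s) → trans M s (IPath.ac π 0) (IPath.st π 1) ≡ true
  headᴵ π = subst (λ s → trans M s (ac 0) (st 1) ≡ true) start (valid 0)
    where open IPath π

  tailᴵ : ∀ {s} (π : IPath M s) → IPath M (IPath.st π 1)
  tailᴵ π = record { st = st ∘ suc ; ac = ac ∘ suc ; start = refl ; valid = valid ∘ suc }
    where open IPath π

  iterate-IPath : ∀ {α} (Inv : Fin n → Set) → (∀ {s} → Inv s → ◇ α Inv s) →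
    ∀ {s} → Inv s → Σ (IPath M s) λ π → ∀ i → IPath.ac π i ∈ α
  iterate-IPath {α} Inv step {s} inv = π , λ i → let (_ , _ , a∈α , _) = next i in a∈α
    where
    state : ℕ → Σ (Fin n) Inv
    state zero    = s , inv
    state (suc i) = let (_ , t , _ , _ , inv-t) = step (proj₂ (state i)) in t , inv-t

    next : ∀ i → ◇ α Inv (proj₁ (state i))
    next i = step (proj₂ (state i))

    π : IPath M s
    π = record
      { st    = proj₁ ∘ state
      ; ac    = proj₁ ∘ next
      ; start = refl
      ; valid = λ i → let (_ , _ , _ , x , _) = next i in x
      }

  progressing-path : ∀ B s → ¬ ¬ Σ (Path M s) (Progressing M B)
  progressing-path B s = ¬¬-excluded-middle {A = ReachesLocked s} >>= λ
    { (yes (u , p , locked)) → return (fin p , locked)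
    ; (no ¬reach) →
        let (π , _) = iterate-IPath {α = ⊤} (¬_ ∘ ReachesLocked) step ¬reach in return (inf π , _)
    }
    where
    ReachesLocked : Fin n → Set
    ReachesLocked s = ∃ λ u → FPath M s u × Locked M B u

    step : ∀ {s} → ¬ ReachesLocked s → ◇ ⊤ (¬_ ∘ ReachesLocked) s
    step {s} ¬reach with any? (λ a → any? (λ t → trans M s a t ≟ true))
    ... | yes (a , t , x) = a , t , ∈⊤ , x , λ (u , p , locked) → ¬reach (u , x ◅ p , locked)
    ... | no ¬step        = ⊥-elim (¬reach (s , [] , λ a t x → ⊥-elim (¬step (a , t , x))))

  module Violation (B αf αe : Subset m) where

    body : Form m
    body = or (diaSet αe tt) (or (boxSet (∁ B) ff) (diaSet (∁ αf) (var 0)))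

    Φ : Env n → Subset n → Subset n
    Φ e P = ⟦ body ⟧ M (update e 0 P)

    ν : Subset n
    ν = ⟦ nu 0 body ⟧ M emptyEnv

    ν≡gfp : ν ≡ gfp (Φ emptyEnv)
    ν≡gfp = ⟦nu⟧≡gfp 0 body emptyEnv

    ViolationStep : (Fin n → Set) → Fin n → Set
    ViolationStep Q s = Enabled αe s ⊎ Locked M B s ⊎ ◇ (∁ αf) Q s

    ∈Φ : ∀ e P {s} → s ∈ Φ e P ⇔ ViolationStep (_∈ P) s
    ∈Φ e P = ⇔-trans (∈⟦or⟧ (diaSet αe tt) (or locked ᾱf-step) e′) (∈⟦⟨α⟩tt⟧ αe e′ ⊎-⇔
             ⇔-trans (∈⟦or⟧ locked ᾱf-step e′) (∈⟦[∁B]ff⟧ B e′ ⊎-⇔ ∈⟦diaSet⟧ (∁ αf) (var 0) e′))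
      where
      e′ = update e 0 P
      locked = boxSet (∁ B) ff
      ᾱf-step = diaSet (∁ αf) (var 0)

    Φ-monotone : ∀ e → Φ e Preserves _⊆_ ⟶ _⊆_
    Φ-monotone e {P} {Q} P⊆Q = from (∈Φ e Q) ∘ Sum.map₂ (Sum.map₂ (◇-map P⊆Q)) ∘ to (∈Φ e P)

    ∈ν⇒ViolationStep : ∀ {s} → s ∈ ν → ViolationStep (_∈ ν) s
    ∈ν⇒ViolationStep s∈ν rewrite ν≡gfp =
      to (∈Φ emptyEnv _) (gfp-postfixed (Φ emptyEnv) (Φ-monotone emptyEnv) s∈ν)

    ViolatingSuffix : Fin n → Set
    ViolatingSuffix t = Σ (Path M t) λ suf → Progressing M B suf × SuffixOK M αf αe suf

    ViolatingSuffix-step : ∀ {s} → ViolatingSuffix s → ViolationStep ViolatingSuffix s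
    ViolatingSuffix-step (_ , _ , inj₂ (_ , [] , a , v , x , _ , refl , a∈αe , _)) =
      inj₁ (a , v , a∈αe , x , _)
    ViolatingSuffix-step
      (_ , prog , inj₂ (_ , y ◅ p , a , v , x , rest , refl , a∈αe , (_ , e-free) , (b∉αf , f-free))) =
      inj₂ (inj₂ (_ , _ , x∉p⇒x∈∁p b∉αf , y , _++ₚ_ M p (_◅ₚ_ M x rest) ,
        from (Progressing-++ₚ p _) (to (Progressing-++ₚ (y ◅ p) _) prog) ,
        inj₂ (_ , p , a , v , x , rest , refl , a∈αe , e-free , f-free)))
    ViolatingSuffix-step (fin [] , locked , inj₁ _) = inj₂ (inj₁ locked)
    ViolatingSuffix-step (fin (x ◅ p) , locked , inj₁ (a∉αf , free)) =
      inj₂ (inj₂ (_ , _ , x∉p⇒x∈∁p a∉αf , x , fin p , locked , inj₁ free))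
    ViolatingSuffix-step (inf π , _ , inj₁ free) =
      inj₂ (inj₂ (_ , _ , x∉p⇒x∈∁p (free 0) , headᴵ π , inf (tailᴵ π) , _ , inj₁ (free ∘ suc)))

    ViolatingSuffix⇒∈ν : ∀ {t} → ViolatingSuffix t → t ∈ ν
    ViolatingSuffix⇒∈ν {t} suf rewrite ν≡gfp = decidable-stable (t ∈? gfp (Φ emptyEnv)) do
      (P , ∈P⇔) ← ¬¬-subset ViolatingSuffix
      let P-postfixed : P ⊆ Φ emptyEnv P
          P-postfixed s∈P = from (∈Φ emptyEnv P)
            (Sum.map₂ (Sum.map₂ (◇-map (from ∈P⇔))) (ViolatingSuffix-step (to ∈P⇔ s∈P)))
      return (gfp-greatest (Φ emptyEnv) P-postfixed (from ∈P⇔ suf))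

    Exit : Fin n → Set
    Exit s = ∃ λ u → Σ (FPath M s u) λ p →
      FFree M αf p × FFree M αe p × (Enabled αe u ⊎ Locked M B u)

    Exit⇒¬¬ViolatingSuffix : ∀ {s} → Exit s → ¬ ¬ ViolatingSuffix s
    Exit⇒¬¬ViolatingSuffix (u , p , f-free , e-free , inj₂ locked) =
      return (fin p , locked , inj₁ f-free)
    Exit⇒¬¬ViolatingSuffix (u , p , f-free , e-free , inj₁ (a , v , a∈αe , x , _)) = do
      (rest , prog) ← progressing-path B v
      return (_++ₚ_ M p (_◅ₚ_ M x rest) ,
              from (Progressing-++ₚ p _) (from (Progressing-◅ₚ x rest) prog) ,
              inj₂ (u , p , a , v , x , rest , refl , a∈αe , e-free , f-free))

    ¬Exit⇒ViolatingSuffix : ∀ {s} → s ∈ ν → ¬ Exit s → ViolatingSuffix s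
    ¬Exit⇒ViolatingSuffix s∈ν ¬exit =
      let (π , ac∈∁αf) = iterate-IPath (λ s → s ∈ ν × ¬ Exit s) step (s∈ν , ¬exit)
      in inf π , _ , inj₁ (x∈∁p⇒x∉p ∘ ac∈∁αf)
      where
      step : ∀ {s} → s ∈ ν × ¬ Exit s → ◇ (∁ αf) (λ s → s ∈ ν × ¬ Exit s) s
      step {s} (s∈ν , ¬exit) with ∈ν⇒ViolationStep s∈ν
      ... | inj₁ enabled       = ⊥-elim (¬exit (s , [] , _ , _ , inj₁ enabled))
      ... | inj₂ (inj₁ locked) = ⊥-elim (¬exit (s , [] , _ , _ , inj₂ locked))
      ... | inj₂ (inj₂ (a , t , a∈∁αf , x , t∈ν)) =
        a , t , a∈∁αf , x , t∈ν , λ (u , p , f-free , e-free , end) →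
          ¬exit (u , x ◅ p , (x∈∁p⇒x∉p a∈∁αf , f-free) , (a∉αe , e-free) , end)
        where
        a∉αe : a ∉ αe
        a∉αe a∈αe = ¬exit (s , [] , _ , _ , inj₁ (a , t , a∈αe , x , _))

    ∈ν⇒¬¬ViolatingSuffix : ∀ {s} → s ∈ ν → ¬ ¬ ViolatingSuffix s
    ∈ν⇒¬¬ViolatingSuffix {s} s∈ν = ¬¬-excluded-middle {A = Exit s} >>= λ
      { (yes exit) → Exit⇒¬¬ViolatingSuffix exit
      ; (no ¬exit) → return (¬Exit⇒ViolatingSuffix s∈ν ¬exit)
      }

    ProgressingViolation : Reg m → Fin n → Set
    ProgressingViolation ρ s = Σ (Path M s) λ π → Progressing M B π × Violating M ρ αf αe π

    ProgressingViolation⇒∈⟨ρ⟩ν : ∀ ρ {s} →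
      ProgressingViolation ρ s → s ∈ ⟦ diaR ρ (nu 0 body) ⟧ M emptyEnv
    ProgressingViolation⇒∈⟨ρ⟩ν ρ (_ , prog , t , pre , suf , refl , pre∈ρ , ok) =
      ⟦diaR⟧-sound pre∈ρ (nu 0 body) emptyEnv pre refl
        (ViolatingSuffix⇒∈ν (suf , to (Progressing-++ₚ pre suf) prog , ok))

    ∈⟨ρ⟩ν⇒¬¬ProgressingViolation : ∀ ρ {s} →
      s ∈ ⟦ diaR ρ (nu 0 body) ⟧ M emptyEnv → ¬ ¬ ProgressingViolation ρ s
    ∈⟨ρ⟩ν⇒¬¬ProgressingViolation ρ s∈ = do
      (t , pre , pre∈ρ , t∈ν) ← ⟦diaR⟧-complete ρ (nu 0 body) emptyEnv s∈
      (suf , prog , ok) ← ∈ν⇒¬¬ViolatingSuffix t∈ν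
      return (_++ₚ_ M pre suf , from (Progressing-++ₚ pre suf) prog ,
              t , pre , suf , refl , pre∈ρ , ok)

theorem21 : ∀ {n m} (M : LTS n m) (B : Subset m) (ρ : Reg m) (αf αe : Subset m) (s : Fin n) →
    (s ∈ ⟦ progFormula B ρ αf αe ⟧ M emptyEnv)
      ⇔ (¬ (Σ (Path M s) λ π → Progressing M B π × Violating M ρ αf αe π))
theorem21 M B ρ αf αe s = mk⇔
  (λ s∉ → x∈∁p⇒x∉p s∉ ∘ ProgressingViolation⇒∈⟨ρ⟩ν ρ)
  (λ ¬violation → x∉p⇒x∈∁p λ s∈ → ∈⟨ρ⟩ν⇒¬¬ProgressingViolation ρ s∈ ¬violation)
  where
  open Violation M B αf αe
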